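{- Let $a\ge1$ and $x\ge2$ be integers, $n=2^a$, and $\omega_n$ the number of distinct prime factors of $x^n-1$. Then $$x\ge\min\left[\left(1+n\prod_{i=1}^{\omega_n}s_i\right)^{1/n},\ \left(1+\prod_{i=2}^{\omega_n+1}s_i\right)^{1/n}\right],$$ where $s_i$ denotes the $i$-th prime. -}

module Defs where

open import Data.Nat.Base using (ℕ; zero; suc; _+_; _*_; _∸_; _!)
open import Data.Nat.Divisibility using (_∣?_)
open import Data.Nat.Primality using (prime?)
open import Data.Bool.Base using (Bool; true; false; _∧_; if_then_else_)
open import Data.List.Base using (List; []; _∷_; length; upTo)
open import Relation.Nullary.Decidable using (does)

-- ω m : number of distinct primes p dividing m (every prime divisor of
-- m ≥ 1 is ≤ m, so we count primes p ∈ {0,…,m} with p ∣ m).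
primeDivisors : ℕ → List ℕ
primeDivisors m = go (upTo (suc m))
  where
  go : List ℕ → List ℕ
  go [] = []
  go (p ∷ ps) = if does (prime? p) ∧ does (p ∣? m) then p ∷ go ps else go ps

ω : ℕ → ℕ
ω m = length (primeDivisors m)

firstPrimeFrom : ℕ → ℕ → ℕ
firstPrimeFrom k zero = k
firstPrimeFrom k (suc fuel) = if does (prime? k) then k else firstPrimeFrom (suc k) fuel

-- nextPrime p : least prime > p.  By Euclid's argument such a prime
-- lies in (p, p! + 1], so the bounded search always succeeds.
nextPrime : ℕ → ℕ
nextPrime p = firstPrimeFrom (suc p) (p !)

-- s i : the i-th prime (1-indexed): s 1 = 2, s 2 = 3, s 3 = 5, …
-- (s 0 is an unused junk value.)
s : ℕ → ℕ
s zero = 0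
s (suc zero) = 2
s (suc (suc i)) = nextPrime (s (suc i))

∏[_from_,_] : (ℕ → ℕ) → ℕ → ℕ → ℕ
∏[ f from a , zero ] = 1
∏[ f from a , suc k ] = f a * ∏[ f from suc a , k ]

-- Let q₁ < ⋯ < q_ω be the prime divisors of N = xⁿ − 1. Being distinct primes, their product
-- divides N, and qᵢ ≥ sᵢ. If N is odd then even qᵢ ≥ sᵢ₊₁, so N ≥ s₂⋯s_{ω+1}. If N is even then
-- x is odd, and since squaring 1 + 2ᵉt gives 1 + 2ᵉ⁺¹t′, 2^{a+1} ∣ x^{2^a} − 1 = N; the odd primes
-- q₂, …, q_ω are coprime to 2^{a+1}, so N ≥ 2^{a+1}·s₂⋯s_ω = n·s₁⋯s_ω.
module Submission where

open import Defs
open import Data.Bool.Base using (true; false; if_then_else_)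
open import Data.Empty using (⊥-elim)
open import Data.List.Base using (List; []; _∷_; length; filter; upTo; applyUpTo)
open import Data.List.Relation.Unary.All as All using (All; []; _∷_)
import Data.List.Relation.Unary.All.Properties as All
open import Data.List.Relation.Unary.AllPairs as AllPairs using (AllPairs; []; _∷_)
import Data.List.Relation.Unary.AllPairs.Properties as AllPairs
open import Data.Nat.Base
open import Data.Nat.Divisibility
open import Data.Nat.ListAction using (product)
open import Data.Nat.Primality
open import Data.Nat.Primality.Factorisation using (factorisationHasAllPrimeFactors)
open import Data.Nat.Properties
open import Algebra.Properties.CommutativeSemigroup *-commutativeSemigroup using (x∙yz≈y∙xz)
open import Data.Nat.Tactic.RingSolver using (solve-∀)
open import Data.Product.Base using (∃-syntax; _×_; _,_; proj₁)
open import Data.Sum.Base using (_⊎_; inj₁; inj₂; [_,_]′)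
open import Function.Base using (id; _∘_; case_of_)
open import Relation.Binary.PropositionalEquality
open import Relation.Nullary.Decidable using (Dec; does; yes; no; _×-dec_)
open import Relation.Nullary.Negation using (¬_)

private
  variable
    d m p q r : ℕ
    qs : List ℕ

module _ (m : ℕ) where

  IsPrimeDivisor? : ∀ p → Dec (Prime p × p ∣ m)
  IsPrimeDivisor? p = prime? p ×-dec p ∣? m

  ≡filter : (g : List ℕ → List ℕ) → g [] ≡ [] →
    (∀ p ps → g (p ∷ ps) ≡ (if does (IsPrimeDivisor? p) then p ∷ g ps else g ps)) →
    ∀ ps → g ps ≡ filter IsPrimeDivisor? ps
  ≡filter g g[] g∷ [] = g[]
  ≡filter g g[] g∷ (p ∷ ps) rewrite g∷ p ps with does (IsPrimeDivisor? p)
  ... | true  = cong (p ∷_) (≡filter g g[] g∷ ps)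
  ... | false = ≡filter g g[] g∷ ps

-- primeDivisors is defined by a local function that cannot be named here; ≡filter
-- recognises it by its defining equations, the `_` being solved once the list is abstracted.
primeDivisors≡filter : ∀ m → primeDivisors m ≡ filter (IsPrimeDivisor? m) (upTo (suc m))
primeDivisors≡filter m with applyUpTo suc m | ≡filter m _ refl (λ _ _ → refl)
... | ps | go≡filter = go≡filter ps

primeDivisors-ascending : ∀ m → AllPairs _<_ (primeDivisors m)
primeDivisors-ascending m rewrite primeDivisors≡filter m =
  AllPairs.filter⁺ (IsPrimeDivisor? m) (AllPairs.applyUpTo⁺₁ id (suc m) (λ i<j _ → i<j))

primeDivisors-sound : ∀ m → All (λ p → Prime p × p ∣ m) (primeDivisors m)
primeDivisors-sound m rewrite primeDivisors≡filter m =
  All.all-filter (IsPrimeDivisor? m) (upTo (suc m))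

prime⇒2≤ : Prime p → 2 ≤ p
prime⇒2≤ {p} pp = nonTrivial⇒n>1 p {{prime⇒nonTrivial pp}}

firstPrimeFrom-least : ∀ {k} fuel → Prime q → k ≤ q → firstPrimeFrom k fuel ≤ q
firstPrimeFrom-least zero pq k≤q = k≤q
firstPrimeFrom-least {q} {k} (suc fuel) pq k≤q with prime? k
... | yes _ = k≤q
... | no ¬pk = firstPrimeFrom-least fuel pq (≤∧≢⇒< k≤q (λ { refl → ¬pk pq }))

nextPrime-least : Prime q → p < q → nextPrime p ≤ q
nextPrime-least {p = p} = firstPrimeFrom-least (p !)

∏s≤product : ∀ c → AllPairs _<_ qs → All Prime qs → All (s (suc c) ≤_) qs →
  ∏[ s from suc c , length qs ] ≤ product qs
∏s≤product c [] [] [] = ≤-refl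
∏s≤product c (q<qs ∷ qs↑) (pq ∷ pqs) (sc≤q ∷ _) =
  *-mono-≤ sc≤q (∏s≤product (suc c) qs↑ pqs (All.zipWith s[2+c]≤ (pqs , q<qs)))
  where
  s[2+c]≤ : Prime r × _ < r → s (suc (suc c)) ≤ r
  s[2+c]≤ (pr , q<r) = nextPrime-least pr (≤-<-trans sc≤q q<r)

prime∤product : Prime q → All Prime qs → All (q ≢_) qs → ¬ q ∣ product qs
prime∤product pq pqs q≢qs q∣∏ =
  All.lookup q≢qs (factorisationHasAllPrimeFactors pq q∣∏ pqs) refl

prime∤⇒*∣ : Prime q → ¬ q ∣ r → q ∣ m → r ∣ m → q * r ∣ m
prime∤⇒*∣ {q} {r} {m} pq q∤r q∣m (divides k m≡k*r) =
  subst (q * r ∣_) (sym m≡k*r) (*-monoˡ-∣ r q∣k)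
  where
  q∣k : q ∣ k
  q∣k = [ id , ⊥-elim ∘ q∤r ]′ (euclidsLemma k r pq (subst (q ∣_) m≡k*r q∣m))

*product∣ : d ∣ m → AllPairs _≢_ qs → All (λ q → Prime q × q ∣ m) qs →
  All (λ q → ¬ q ∣ d) qs → d * product qs ∣ m
*product∣ {d} d∣m [] [] [] = subst (_∣ _) (sym (*-identityʳ d)) d∣m
*product∣ {d} {m} {q ∷ qs} d∣m (q≢qs ∷ qs≢) ((pq , q∣m) ∷ ds) (q∤d ∷ ∤d) =
  subst (_∣ m) (x∙yz≈y∙xz q d (product qs))
    (prime∤⇒*∣ pq q∤d∏ q∣m (*product∣ d∣m qs≢ ds ∤d))
  where
  q∤d∏ : ¬ q ∣ d * product qs
  q∤d∏ q∣d∏ = [ q∤d , prime∤product pq (All.map proj₁ ds) q≢qs ]′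
    (euclidsLemma d (product qs) pq q∣d∏)

odd-prime∤2^ : ∀ e → Prime q → 2 < q → ¬ q ∣ 2 ^ e
odd-prime∤2^ zero pq 2<q q∣1 = <-irrefl (sym (∣1⇒≡1 q∣1)) (<-trans (n<1+n 1) 2<q)
odd-prime∤2^ (suc e) pq 2<q q∣2^[1+e] with euclidsLemma 2 (2 ^ e) pq q∣2^[1+e]
... | inj₁ q∣2   = <⇒≱ 2<q (∣⇒≤ q∣2)
... | inj₂ q∣2^e = odd-prime∤2^ e pq 2<q q∣2^e

2^e*∏s≤ : ∀ e .{{_ : NonZero m}} → 2 ^ e ∣ m → AllPairs _<_ qs →
  All (λ q → Prime q × q ∣ m) qs → All (2 <_) qs → 2 ^ e * ∏[ s from 2 , length qs ] ≤ m
2^e*∏s≤ {m} {qs} e 2^e∣m qs↑ ds 2<qs = begin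
  2 ^ e * ∏[ s from 2 , length qs ] ≤⟨ *-monoʳ-≤ (2 ^ e) (∏s≤product 1 qs↑ primes s₂≤qs) ⟩
  2 ^ e * product qs                ≤⟨ ∣⇒≤ (*product∣ 2^e∣m (AllPairs.map <⇒≢ qs↑) ds qs∤2^e) ⟩
  m                                 ∎
  where
  open ≤-Reasoning
  primes : All Prime qs
  primes = All.map proj₁ ds
  s₂≤qs : All (s 2 ≤_) qs
  s₂≤qs = All.zipWith (λ (pq , 2<q) → nextPrime-least pq 2<q) (primes , 2<qs)
  qs∤2^e : All (λ q → ¬ q ∣ 2 ^ e) qs
  qs∤2^e = All.zipWith (λ (pq , 2<q) → odd-prime∤2^ e pq 2<q) (primes , 2<qs)

even⊎odd : ∀ x → 2 ∣ x ⊎ (∃[ k ] x ≡ 1 + 2 * k)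
even⊎odd zero = inj₁ (divides 0 refl)
even⊎odd (suc zero) = inj₂ (0 , refl)
even⊎odd (suc (suc x)) with even⊎odd x
... | inj₁ 2∣x = inj₁ (∣m∣n⇒∣m+n ∣-refl 2∣x)
... | inj₂ (k , x≡1+2k) =
  inj₂ (suc k , trans (cong (2 +_) x≡1+2k) (cong suc (sym (*-suc 2 k))))

∣⇒∣^ : d ∣ m → ∀ n .{{_ : NonZero n}} → d ∣ m ^ n
∣⇒∣^ {m = m} d∣m (suc n) = ∣m⇒∣m*n (m ^ n) d∣m

[1+2k]^2^a≡1+2^[1+a]*t : ∀ a k → ∃[ t ] (1 + 2 * k) ^ 2 ^ a ≡ 1 + 2 ^ suc a * t
[1+2k]^2^a≡1+2^[1+a]*t zero k = k , *-identityʳ (1 + 2 * k)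
[1+2k]^2^a≡1+2^[1+a]*t (suc a) k with [1+2k]^2^a≡1+2^[1+a]*t a k
... | t , y^2^a≡ = t + 2 ^ a * (t * t) , (begin
  y ^ (2 * 2 ^ a)            ≡⟨ cong (y ^_) (*-comm 2 (2 ^ a)) ⟩
  y ^ (2 ^ a * 2)            ≡⟨ ^-*-assoc y (2 ^ a) 2 ⟨
  (y ^ 2 ^ a) ^ 2            ≡⟨ cong (_^ 2) y^2^a≡ ⟩
  (1 + 2 * 2 ^ a * t) ^ 2    ≡⟨ square (2 ^ a) t ⟩
  1 + 2 * (2 * 2 ^ a) * (t + 2 ^ a * (t * t)) ∎)
  where
  open ≡-Reasoning
  y = 1 + 2 * k
  square : ∀ u t →
    (1 + 2 * u * t) * ((1 + 2 * u * t) * 1) ≡ 1 + 2 * (2 * u) * (t + u * (t * t))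
  square = solve-∀

2∣N⇒2^[1+a]∣N : ∀ a {x N} → x ^ 2 ^ a ≡ 1 + N → 2 ∣ N → 2 ^ suc a ∣ N
2∣N⇒2^[1+a]∣N a {x} {N} x^n≡1+N 2∣N with even⊎odd x
... | inj₁ 2∣x = ⊥-elim (2∤1 (∣m+n∣m⇒∣n 2∣N+1 2∣N))
  where
  2∤1 : ¬ 2 ∣ 1
  2∤1 2∣1 = case ∣1⇒≡1 2∣1 of λ ()
  2∣N+1 : 2 ∣ N + 1
  2∣N+1 = subst (2 ∣_) (trans x^n≡1+N (+-comm 1 N)) (∣⇒∣^ 2∣x (2 ^ a) {{m^n≢0 2 a}})
... | inj₂ (k , refl) with [1+2k]^2^a≡1+2^[1+a]*t a k
...   | t , x^n≡ = subst (2 ^ suc a ∣_) (suc-injective (trans (sym x^n≡) x^n≡1+N)) (m∣m*n t)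

∏s≤ : .{{_ : NonZero m}} → AllPairs _<_ qs → All (λ q → Prime q × q ∣ m) qs →
  All (2 <_) qs → ∏[ s from 2 , length qs ] ≤ m
∏s≤ {m} qs↑ ds 2<qs = subst (_≤ m) (*-identityˡ _) (2^e*∏s≤ 0 (1∣ m) qs↑ ds 2<qs)

ascendingPrimeDivisors-bound : ∀ a {x N} .{{_ : NonZero N}} → x ^ 2 ^ a ≡ 1 + N →
  AllPairs _<_ qs → All (λ p → Prime p × p ∣ N) qs →
  (2 ^ a * ∏[ s from 1 , length qs ]) ⊓ ∏[ s from 2 , length qs ] ≤ N
ascendingPrimeDivisors-bound a x^n≡1+N [] [] = ≤-trans (m⊓n≤n _ _) (∏s≤ [] [] [])
ascendingPrimeDivisors-bound {q ∷ qs} a {N = N} x^n≡1+N q∷qs↑@(q<qs ∷ qs↑) q∷ds@((pq , q∣N) ∷ ds)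
  with q ≟ 2
... | no q≢2 = ≤-trans (m⊓n≤n _ _) (∏s≤ q∷qs↑ q∷ds (2<q ∷ All.map (<-trans 2<q) q<qs))
  where
  2<q : 2 < q
  2<q = ≤∧≢⇒< (prime⇒2≤ pq) (q≢2 ∘ sym)
... | yes refl = ≤-trans (m⊓n≤m _ _) (begin
  2 ^ a * (2 * ∏[ s from 2 , length qs ]) ≡⟨ x∙yz≈y∙xz (2 ^ a) 2 _ ⟩
  2 * (2 ^ a * ∏[ s from 2 , length qs ]) ≡⟨ *-assoc 2 (2 ^ a) _ ⟨
  2 ^ suc a * ∏[ s from 2 , length qs ]   ≤⟨ 2^e*∏s≤ (suc a) 2^[1+a]∣N qs↑ ds q<qs ⟩
  N                                       ∎)
  where
  open ≤-Reasoning
  2^[1+a]∣N : 2 ^ suc a ∣ N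
  2^[1+a]∣N = 2∣N⇒2^[1+a]∣N a x^n≡1+N q∣N

corollary5p3 : (a x : ℕ) → 1 ≤ a → 2 ≤ x →
    let n = 2 ^ a
        ωn = ω (x ^ n ∸ 1)
    in (1 + n * ∏[ s from 1 , ωn ]) ⊓ (1 + ∏[ s from 2 , ωn ]) ≤ x ^ n
corollary5p3 a x _ 2≤x = ≤-trans
  (s≤s (ascendingPrimeDivisors-bound a x^n≡1+N
    (primeDivisors-ascending N) (primeDivisors-sound N)))
  (≤-reflexive (sym x^n≡1+N))
  where
  N = x ^ 2 ^ a ∸ 1
  instance
    x≢0 : NonZero x
    x≢0 = >-nonZero (<-trans z<s 2≤x)
  2≤x^n : 2 ≤ x ^ 2 ^ a
  2≤x^n = ≤-trans 2≤x (≤-trans (≤-reflexive (sym (^-identityʳ x))) (^-monoʳ-≤ x (m^n>0 2 a)))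
  x^n≡1+N : x ^ 2 ^ a ≡ 1 + N
  x^n≡1+N = sym (m+[n∸m]≡n (≤-trans (n≤1+n 1) 2≤x^n))
  instance
    N≢0 : NonZero N
    N≢0 = >-nonZero (s≤s⁻¹ (subst (2 ≤_) x^n≡1+N 2≤x^n))
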